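{- For every $n\ge1$ and every integer $k>2^{n-1}$ (with $k\le 2^n$), $F_n(k)=A_n(k)$.
   Context: $Q_n=[0,1]^n$, $V_n=\{0,1\}^n$. A $0/1$-polytope of $Q_n$ is the convex hull of a nonempty subset of $V_n$; it has $k$ vertices if that subset has $k$ elements. The hyperoctahedral group $B_n$ consists of signed permutations $w$ of $\{1,\dots,n\}$ (a permutation $\pi$ with a sign $\pm$ attached to each $i$), acting on $\mathbb{R}^n$ by $w(x)_i=x_{\pi(i)}$ if $i$ has sign $+$ and $w(x)_i=1-x_{\pi(i)}$ if $i$ has sign $-$; these are the symmetries of $Q_n$. Two $0/1$-polytopes are $0/1$-equivalent if one is the image of the other under some $w\in B_n$. $A_n(k)$ is the number of $0/1$-equivalence classes of $0/1$-polytopes of $Q_n$ with $k$ vertices, and $F_n(k)$ is the number of such classes consisting of full-dimensional (i.e. $n$-dimensional) polytopes. -}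

module Defs where

open import Data.Nat using (ℕ; zero; suc)
open import Data.Bool using (Bool; true; false; not; if_then_else_)
open import Data.Fin using (Fin; zero; suc)
open import Data.Fin.Permutation using (Permutation′; _⟨$⟩ʳ_)
open import Data.Vec using (Vec; lookup; tabulate)
open import Data.List using (List; map; length)
open import Data.List.Membership.Propositional using (_∈_)
open import Data.List.Relation.Unary.All using (All)
open import Data.List.Relation.Unary.Any using (Any)
open import Data.List.Relation.Unary.AllPairs using (AllPairs)
open import Data.List.Relation.Unary.Unique.Propositional using (Unique)
open import Data.Rational using (ℚ; 0ℚ; 1ℚ; _+_; _*_)
open import Data.Product using (Σ; _×_; ∃)
open import Relation.Binary.PropositionalEquality using (_≡_)
open import Relation.Nullary using (¬_)
open import Function.Bundles using (_⇔_)

-- Vertices of the cube Q_n: V_n = {0,1}^n  (false = 0, true = 1).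
V : ℕ → Set
V n = Vec Bool n

-- Signed permutations (hyperoctahedral group B_n): a permutation π of
-- Fin n together with a sign for each i (true = sign minus).
B : ℕ → Set
B n = Permutation′ n × (Fin n → Bool)

act : ∀ {n} → B n → V n → V n
act (π Data.Product., s) x =
  tabulate (λ i → if s i then not (lookup x (π ⟨$⟩ʳ i)) else lookup x (π ⟨$⟩ʳ i))

-- A 0/1-polytope is represented by its (duplicate-free) vertex set S ⊆ V_n;
-- it is conv(S). It has k vertices iff S has k elements.
KVertexSet : (n k : ℕ) → List (V n) → Set
KVertexSet n k S = Unique S × length S ≡ k

SameSet : ∀ {n} → List (V n) → List (V n) → Set
SameSet S T = ∀ x → (x ∈ S) ⇔ (x ∈ T)

-- 0/1-equivalence: conv(T) = w(conv(S)) = conv(w(S)) for some w ∈ B_n.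
Equiv01 : ∀ {n} → List (V n) → List (V n) → Set
Equiv01 {n} S T = ∃ λ (w : B n) → SameSet (map (act w) S) T

sumFin : ∀ {m} → (Fin m → ℚ) → ℚ
sumFin {zero} f = 0ℚ
sumFin {suc m} f = f zero + sumFin (λ i → f (suc i))

bit : Bool → ℚ
bit true = 1ℚ
bit false = 0ℚ

AffinelyIndependent : ∀ {n m} → (Fin m → V n) → Set
AffinelyIndependent {n} {m} p =
  ∀ (λ′ : Fin m → ℚ) → sumFin λ′ ≡ 0ℚ →
  (∀ (j : Fin n) → sumFin (λ i → λ′ i * bit (lookup (p i) j)) ≡ 0ℚ) →
  ∀ i → λ′ i ≡ 0ℚ

-- conv(S) is n-dimensional: its affine hull (= affine hull of S) has
-- dimension n, i.e. S contains n+1 affinely independent points.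
FullDimensional : ∀ {n} → List (V n) → Set
FullDimensional {n} S =
  ∃ λ (p : Fin (suc n) → V n) → (∀ i → p i ∈ S) × AffinelyIndependent p

-- "The family of vertex sets satisfying P (closed under 0/1-equivalence)
-- has exactly m 0/1-equivalence classes": there is a list of m
-- representatives satisfying P, pairwise inequivalent, such that every
-- vertex set satisfying P is equivalent to one of them.
NumClasses : ∀ {n} → (List (V n) → Set) → ℕ → Set
NumClasses {n} P m =
  Σ (List (List (V n))) λ reps →
    (length reps ≡ m) × All P reps ×
    AllPairs (λ S T → ¬ Equiv01 S T) reps ×
    (∀ S → P S → Any (Equiv01 S) reps)

A-is : (n k m : ℕ) → Set
A-is n k m = NumClasses (KVertexSet n k) m

F-is : (n k m : ℕ) → Set
F-is n k m = NumClasses (λ S → KVertexSet n k S × FullDimensional S) m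

module Submission where

open import Defs
open import Data.Nat using (ℕ; _≤_; _<_; _^_; _∸_)
open import Data.Product using (∃; _×_)

open import Data.Nat using (zero; suc; _+_; _*_; z≤n; s≤s; z<s; _<?_; _≟_)
open import Data.Nat.Properties
  using (+-identityʳ; +-suc; +-comm; +-mono-≤; *-distribˡ-+; *-cancelˡ-<; *-monoʳ-<; <⇒≱; ≮⇒≥;
         module ≤-Reasoning)
open import Data.Bool using (Bool; true; false; not; if_then_else_)
import Data.Bool.Properties as Bool
open import Data.Fin using (Fin; zero; suc; punchIn)
open import Data.Fin.Permutation using (Permutation′; _⟨$⟩ʳ_; _≈_; id; insert; remove; insert-remove; insert-punchIn)
open import Data.Vec using (Vec; []; _∷_; lookup; tabulate)
open import Data.Vec.Properties using (lookup∘tabulate; tabulate∘lookup; tabulate-cong)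
import Data.Vec.Properties as Vec
open import Data.List using (List; []; _∷_; length; map; filter; foldr; allFin; cartesianProductWith; cartesianProduct)
open import Data.List.Properties using (map-cong; map-id)
open import Data.List.Membership.Propositional using (_∈_; lose)
open import Data.List.Membership.Propositional.Properties
  using (∈-map⁺; ∈-allFin; ∈-filter⁺; ∈-filter⁻; ∈-cartesianProductWith⁺; ∈-cartesianProduct⁺)
import Data.List.Relation.Binary.Subset.DecPropositional as Subset
open import Data.List.Relation.Unary.All using (All; []; _∷_)
import Data.List.Relation.Unary.All as All
open import Data.List.Relation.Unary.All.Properties using (¬Any⇒All¬)
open import Data.List.Relation.Unary.Any using (Any; here; there; any?; satisfied)
open import Data.List.Relation.Unary.AllPairs using (AllPairs; []; _∷_)
open import Data.List.Relation.Unary.Unique.Propositional using (Unique)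
import Data.List.Relation.Unary.Unique.DecPropositional as DecUnique
open import Data.Rational using (ℚ; 0ℚ; 1ℚ)
import Data.Rational as ℚ
import Data.Rational.Properties as ℚ
open import Data.Product using (_,_; proj₁; proj₂; uncurry)
open import Data.Sum using (_⊎_; inj₁; inj₂; [_,_])
open import Data.Empty using (⊥-elim)
open import Function using (_∘_)
open import Function.Bundles using (_⇔_; mk⇔; Equivalence)
open import Relation.Binary.Definitions using (DecidableEquality)
open import Relation.Binary.PropositionalEquality using (_≡_; refl; sym; trans; cong; cong₂; subst)
open import Relation.Nullary using (¬_; Dec; yes; no; _×-dec_)
open import Relation.Nullary.Decidable using (map′)

-- A set S ⊆ V_n with more than 2^(n-1) points is
-- full-dimensional.  Split S along the first coordinate into its two facet
-- parts; both have at most 2^(n-1) points, so one of them, S_c, has more than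
-- half of the vertices of its facet Q_(n-1) (hence is full-dimensional there
-- by induction) while the other is nonempty.  Adding a point off the facet
-- to n affinely independent points of the facet gives n+1 affinely
-- independent points of Q_n.
--
-- Counting part.  0/1-equivalence is decidable (B_n is finite), and the
-- k-vertex sets all occur in a finite list; a greedy pass over that list
-- yields a list of pairwise inequivalent representatives, so A_n(k) exists.
-- Since every k-vertex set is full-dimensional, the same representatives
-- count F_n(k).

sumFin-cong : ∀ {m} {f g : Fin m → ℚ} → (∀ i → f i ≡ g i) → sumFin f ≡ sumFin g
sumFin-cong {zero} f≡g = refl
sumFin-cong {suc m} f≡g = cong₂ ℚ._+_ (f≡g zero) (sumFin-cong (f≡g ∘ suc))

sumFin-*0 : ∀ {m} (f : Fin m → ℚ) → sumFin (λ i → f i ℚ.* 0ℚ) ≡ 0ℚ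
sumFin-*0 {zero} f = refl
sumFin-*0 {suc m} f =
  trans (cong₂ ℚ._+_ (ℚ.*-zeroʳ (f zero)) (sumFin-*0 (f ∘ suc))) (ℚ.+-identityˡ 0ℚ)

sumFin-*1 : ∀ {m} (f : Fin m → ℚ) → sumFin (λ i → f i ℚ.* 1ℚ) ≡ sumFin f
sumFin-*1 f = sumFin-cong (λ i → ℚ.*-identityʳ (f i))

+≡0⇒right≡0 : ∀ {x y} → x ℚ.+ y ≡ 0ℚ → x ≡ 0ℚ → y ≡ 0ℚ
+≡0⇒right≡0 {y = y} x+y≡0 refl = trans (sym (ℚ.+-identityˡ y)) x+y≡0

+≡0⇒left≡0 : ∀ {x y} → x ℚ.+ y ≡ 0ℚ → y ≡ 0ℚ → x ≡ 0ℚ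
+≡0⇒left≡0 {x} x+y≡0 refl = trans (sym (ℚ.+-identityʳ x)) x+y≡0

point-affinelyIndependent : ∀ {n} (x : V n) → AffinelyIndependent {n} {1} (λ _ → x)
point-affinelyIndependent x λ′ Σλ≡0 _ zero = +≡0⇒left≡0 Σλ≡0 refl

pyramid : ∀ {n m} → Bool → V n → (Fin m → V n) → Fin (suc m) → V (suc n)
pyramid c r q zero = not c ∷ r
pyramid c r q (suc i) = c ∷ q i

-- The first coordinate of an affine dependence of a pyramid forces the apex
-- coefficient, and hence the sum of the other coefficients, to vanish.
apex-coefficient : ∀ {m} c (λ′ : Fin (suc m) → ℚ) → sumFin λ′ ≡ 0ℚ →
  λ′ zero ℚ.* bit (not c) ℚ.+ sumFin (λ i → λ′ (suc i) ℚ.* bit c) ≡ 0ℚ →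
  λ′ zero ≡ 0ℚ × sumFin (λ′ ∘ suc) ≡ 0ℚ
apex-coefficient false λ′ Σλ≡0 first = apex≡0 , +≡0⇒right≡0 Σλ≡0 apex≡0
  where
  apex≡0 : λ′ zero ≡ 0ℚ
  apex≡0 = trans (sym (ℚ.*-identityʳ _)) (+≡0⇒left≡0 first (sumFin-*0 (λ′ ∘ suc)))
apex-coefficient true λ′ Σλ≡0 first = +≡0⇒left≡0 Σλ≡0 rest≡0 , rest≡0
  where
  rest≡0 : sumFin (λ′ ∘ suc) ≡ 0ℚ
  rest≡0 = trans (sym (sumFin-*1 (λ′ ∘ suc))) (+≡0⇒right≡0 first (ℚ.*-zeroʳ (λ′ zero)))

pyramid-affinelyIndependent : ∀ {n m} c (r : V n) (q : Fin m → V n) →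
  AffinelyIndependent q → AffinelyIndependent (pyramid c r q)
pyramid-affinelyIndependent c r q q-indep λ′ Σλ≡0 Σλp≡0 = coefficient≡0
  where
  apex : λ′ zero ≡ 0ℚ × sumFin (λ′ ∘ suc) ≡ 0ℚ
  apex = apex-coefficient c λ′ Σλ≡0 (Σλp≡0 zero)

  facet-dependence : ∀ j → sumFin (λ i → λ′ (suc i) ℚ.* bit (lookup (q i) j)) ≡ 0ℚ
  facet-dependence j = +≡0⇒right≡0 (Σλp≡0 (suc j))
    (trans (cong (ℚ._* bit (lookup r j)) (proj₁ apex)) (ℚ.*-zeroˡ (bit (lookup r j))))

  coefficient≡0 : ∀ i → λ′ i ≡ 0ℚ
  coefficient≡0 zero = proj₁ apex
  coefficient≡0 (suc i) = q-indep (λ′ ∘ suc) (proj₂ apex) facet-dependence i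

facet : ∀ {n} → Bool → List (V (suc n)) → List (V n)
facet c [] = []
facet c ((b ∷ v) ∷ S) with b Bool.≟ c
... | yes _ = v ∷ facet c S
... | no _ = facet c S

facet-∈ : ∀ {n} c (S : List (V (suc n))) {v} → v ∈ facet c S → (c ∷ v) ∈ S
facet-∈ c ((b ∷ v) ∷ S) v∈ with b Bool.≟ c | v∈
... | yes refl | here refl = here refl
... | yes refl | there v∈′ = there (facet-∈ c S v∈′)
... | no _ | v∈′ = there (facet-∈ c S v∈′)

facet-unique : ∀ {n} c (S : List (V (suc n))) → Unique S → Unique (facet c S)
facet-unique c [] [] = []
facet-unique c ((b ∷ v) ∷ S) (fresh ∷ unique) with b Bool.≟ c
... | yes refl =
  All.tabulate (λ w∈ v≡w → All.lookup fresh (facet-∈ c S w∈) (cong (c ∷_) v≡w))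
    ∷ facet-unique c S unique
... | no _ = facet-unique c S unique

facet-length : ∀ {n} (S : List (V (suc n))) →
  length S ≡ length (facet false S) + length (facet true S)
facet-length [] = refl
facet-length ((false ∷ v) ∷ S) = cong suc (facet-length S)
facet-length ((true ∷ v) ∷ S) =
  trans (cong suc (facet-length S)) (sym (+-suc (length (facet false S)) _))

unique-length≤ : ∀ n (S : List (V n)) → Unique S → length S ≤ 2 ^ n
unique-length≤ zero [] _ = z≤n
unique-length≤ zero (x ∷ []) _ = s≤s z≤n
unique-length≤ zero ([] ∷ [] ∷ S) ((x≢y ∷ _) ∷ _) = ⊥-elim (x≢y refl)
unique-length≤ (suc n) S unique = begin
  length S                                        ≡⟨ facet-length S ⟩
  length (facet false S) + length (facet true S)  ≤⟨ +-mono-≤ (bound false) (bound true) ⟩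
  2 ^ n + 2 ^ n                                   ≡⟨ cong (2 ^ n +_) (sym (+-identityʳ (2 ^ n))) ⟩
  2 ^ suc n                                       ∎
  where
  open ≤-Reasoning
  bound : ∀ c → length (facet c S) ≤ 2 ^ n
  bound c = unique-length≤ n (facet c S) (facet-unique c S unique)

positive-summand : ∀ {N x y} → x ≤ N → N < x + y → 0 < y
positive-summand {N} {x} {zero} x≤N N<x+0 =
  ⊥-elim (<⇒≱ N<x+0 (subst (_≤ N) (sym (+-identityʳ x)) x≤N))
positive-summand {y = suc _} _ _ = z<s

more-than-half-split : ∀ {N} a b → a ≤ N → b ≤ N → 2 * N < 2 * (a + b) →
  (N < 2 * a × 0 < b) ⊎ (N < 2 * b × 0 < a)
more-than-half-split {N} a b a≤N b≤N 2N<2[a+b] = split (N <? 2 * a) (N <? 2 * b)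
  where
  open ≤-Reasoning
  N<a+b : N < a + b
  N<a+b = *-cancelˡ-< 2 N (a + b) 2N<2[a+b]
  split : Dec (N < 2 * a) → Dec (N < 2 * b) → (N < 2 * a × 0 < b) ⊎ (N < 2 * b × 0 < a)
  split (yes N<2a) _ = inj₁ (N<2a , positive-summand a≤N N<a+b)
  split (no _) (yes N<2b) = inj₂ (N<2b , positive-summand b≤N (subst (N <_) (+-comm a b) N<a+b))
  split (no N≮2a) (no N≮2b) = ⊥-elim (<⇒≱ 2N<2[a+b] (begin
    2 * (a + b)    ≡⟨ *-distribˡ-+ 2 a b ⟩
    2 * a + 2 * b  ≤⟨ +-mono-≤ (≮⇒≥ N≮2a) (≮⇒≥ N≮2b) ⟩
    N + N          ≡⟨ cong (N +_) (sym (+-identityʳ N)) ⟩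
    2 * N          ∎))

some-member : ∀ {A : Set} (L : List A) → 0 < length L → ∃ (_∈ L)
some-member (x ∷ _) _ = x , here refl

facet-fullDimensional : ∀ {n} c (S : List (V (suc n))) {r} → (not c ∷ r) ∈ S →
  FullDimensional (facet c S) → FullDimensional S
facet-fullDimensional c S {r} r∈S (q , q∈ , q-indep) =
  pyramid c r q , members , pyramid-affinelyIndependent c r q q-indep
  where
  members : ∀ i → pyramid c r q i ∈ S
  members zero = r∈S
  members (suc i) = facet-∈ c S (q∈ i)

large-fullDimensional : ∀ n (S : List (V n)) → Unique S → 2 ^ n < 2 * length S →
  FullDimensional S
large-fullDimensional zero [] _ ()
large-fullDimensional zero (x ∷ _) _ _ = (λ _ → x) , (λ _ → here refl) , point-affinelyIndependent x
large-fullDimensional (suc n) S unique large =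
  [ uncurry (through false) , uncurry (through true) ]
    (more-than-half-split _ _ (bound false) (bound true)
      (subst (λ l → 2 * 2 ^ n < 2 * l) (facet-length S) large))
  where
  bound : ∀ c → length (facet c S) ≤ 2 ^ n
  bound c = unique-length≤ n (facet c S) (facet-unique c S unique)
  through : ∀ c → 2 ^ n < 2 * length (facet c S) → 0 < length (facet (not c) S) →
    FullDimensional S
  through c big nonempty with some-member (facet (not c) S) nonempty
  ... | r , r∈ = facet-fullDimensional c S (facet-∈ (not c) S r∈)
    (large-fullDimensional n (facet c S) (facet-unique c S unique) big)

kVertexSet-fullDimensional : ∀ n k → 2 ^ n < k →
  ∀ S → KVertexSet (suc n) k S → FullDimensional S
kVertexSet-fullDimensional n k more-than-half S (unique , S-length) =
  large-fullDimensional (suc n) S unique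
    (subst (λ l → 2 ^ suc n < 2 * l) (sym S-length) (*-monoʳ-< 2 more-than-half))

words : ∀ {A : Set} → ℕ → List A → List (List A)
words zero xs = [] ∷ []
words (suc k) xs = cartesianProductWith _∷_ xs (words k xs)

words-complete : ∀ {A : Set} {xs : List A} (ys : List A) → All (_∈ xs) ys →
  ys ∈ words (length ys) xs
words-complete [] [] = here refl
words-complete (y ∷ ys) (y∈ ∷ ys∈) = ∈-cartesianProductWith⁺ _∷_ y∈ (words-complete ys ys∈)

vertices : ∀ n → List (V n)
vertices zero = [] ∷ []
vertices (suc n) = cartesianProductWith _∷_ (true ∷ false ∷ []) (vertices n)

vertices-complete : ∀ {n} (x : V n) → x ∈ vertices n
vertices-complete [] = here refl
vertices-complete (b ∷ x) = ∈-cartesianProductWith⁺ _∷_ (bool∈ b) (vertices-complete x)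
  where
  bool∈ : ∀ b → b ∈ true ∷ false ∷ []
  bool∈ true = here refl
  bool∈ false = there (here refl)

-- All permutations of Fin n up to pointwise equality: a permutation of
-- Fin (1+n) is determined by the image of 0 and the permutation it induces
-- on the remaining points.
permutations : ∀ n → List (Permutation′ n)
permutations zero = id ∷ []
permutations (suc n) = cartesianProductWith (insert zero) (allFin (suc n)) (permutations n)

insert-cong : ∀ {n} j {ρ ρ′ : Permutation′ n} → ρ ≈ ρ′ → insert zero j ρ ≈ insert zero j ρ′
insert-cong j ρ≈ρ′ zero = refl
insert-cong j {ρ} {ρ′} ρ≈ρ′ (suc i) =
  trans (insert-punchIn zero j ρ i) (trans (cong (punchIn j) (ρ≈ρ′ i)) (sym (insert-punchIn zero j ρ′ i)))

permutations-complete : ∀ {n} (π : Permutation′ n) → ∃ λ ρ → ρ ∈ permutations n × π ≈ ρ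
permutations-complete {zero} π = id , here refl , λ ()
permutations-complete {suc n} π with permutations-complete (remove zero π)
... | ρ , ρ∈ , π′≈ρ =
  insert zero (π ⟨$⟩ʳ zero) ρ ,
  ∈-cartesianProductWith⁺ (insert zero) (∈-allFin (π ⟨$⟩ʳ zero)) ρ∈ ,
  λ i → trans (sym (insert-remove zero π i)) (insert-cong (π ⟨$⟩ʳ zero) π′≈ρ i)

-- All signed permutations, up to having the same action on vertices; a sign
-- vector is read off from a vertex.
signedPermutations : ∀ n → List (B n)
signedPermutations n = cartesianProduct (permutations n) (map lookup (vertices n))

signedPermutations-complete : ∀ {n} (w : B n) →
  ∃ λ w′ → w′ ∈ signedPermutations n × (∀ x → act w x ≡ act w′ x)
signedPermutations-complete (π , s) with permutations-complete π
... | ρ , ρ∈ , π≈ρ =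
  (ρ , lookup (tabulate s)) ,
  ∈-cartesianProduct⁺ ρ∈ (∈-map⁺ lookup (vertices-complete (tabulate s))) ,
  λ x → tabulate-cong (λ i →
    cong₂ (λ b j → if b then not (lookup x j) else lookup x j) (sym (lookup∘tabulate s i)) (π≈ρ i))

_≟V_ : ∀ {n} → DecidableEquality (V n)
_≟V_ = Vec.≡-dec Bool._≟_

sameSet? : ∀ {n} (S T : List (V n)) → Dec (SameSet S T)
sameSet? S T = map′
  (λ (S⊆T , T⊆S) x → mk⇔ (λ x∈S → S⊆T x∈S) (λ x∈T → T⊆S x∈T))
  (λ same → (λ {x} → Equivalence.to (same x)) , (λ {x} → Equivalence.from (same x)))
  (Subset._⊆?_ _≟V_ S T ×-dec Subset._⊆?_ _≟V_ T S)

equiv01? : ∀ {n} (S T : List (V n)) → Dec (Equiv01 S T)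
equiv01? {n} S T = map′ satisfied search-complete (any? (λ w → sameSet? (map (act w) S) T) (signedPermutations n))
  where
  search-complete : Equiv01 S T → Any (λ w → SameSet (map (act w) S) T) (signedPermutations n)
  search-complete (w , same) with signedPermutations-complete w
  ... | w′ , w′∈ , same-action = lose w′∈ (subst (λ L → SameSet L T) (map-cong same-action S) same)

equiv01-refl : ∀ {n} (S : List (V n)) → Equiv01 S S
equiv01-refl S = (id , λ _ → false) , λ x →
  subst (λ L → (x ∈ L) ⇔ (x ∈ S)) (sym fixes) (mk⇔ (λ p → p) (λ p → p))
  where
  fixes : map (act (id , λ _ → false)) S ≡ S
  fixes = trans (map-cong tabulate∘lookup S) (map-id S)

-- No symmetry or transitivity of _~_ is needed.
module Representatives {A : Set} (_~_ : A → A → Set) (_~?_ : ∀ x y → Dec (x ~ y)) where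

  addRep : A → List A → List A
  addRep c rs with any? (c ~?_) rs
  ... | yes _ = rs
  ... | no _ = c ∷ rs

  representatives : List A → List A
  representatives = foldr addRep []

  representatives-⊆ : ∀ cs {r} → r ∈ representatives cs → r ∈ cs
  representatives-⊆ (c ∷ cs) r∈ with any? (c ~?_) (representatives cs) | r∈
  ... | yes _ | r∈′ = there (representatives-⊆ cs r∈′)
  ... | no _ | here refl = here refl
  ... | no _ | there r∈′ = there (representatives-⊆ cs r∈′)

  representatives-distinct : ∀ cs → AllPairs (λ a b → ¬ a ~ b) (representatives cs)
  representatives-distinct [] = []
  representatives-distinct (c ∷ cs) with any? (c ~?_) (representatives cs)
  ... | yes _ = representatives-distinct cs
  ... | no unrelated = ¬Any⇒All¬ _ unrelated ∷ representatives-distinct cs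

  addRep-keeps : ∀ {Q : A → Set} c rs → Any Q rs → Any Q (addRep c rs)
  addRep-keeps c rs q with any? (c ~?_) rs
  ... | yes _ = q
  ... | no _ = there q

  representatives-cover : (∀ x → x ~ x) → ∀ cs {c} → c ∈ cs → Any (c ~_) (representatives cs)
  representatives-cover ~-refl (c ∷ cs) (here refl) with any? (c ~?_) (representatives cs)
  ... | yes related = related
  ... | no _ = here (~-refl c)
  representatives-cover ~-refl (c ∷ cs) (there c′∈) =
    addRep-keeps c _ (representatives-cover ~-refl cs c′∈)

finite-numClasses : ∀ {n} {P : List (V n) → Set} → (∀ S → Dec (P S)) →
  (candidates : List (List (V n))) → (∀ S → P S → S ∈ candidates) → ∃ λ m → NumClasses P m
finite-numClasses {n} {P} P? candidates complete =
  length reps , reps , refl , all-P , representatives-distinct (filter P? candidates) , cover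
  where
  open Representatives (Equiv01 {n}) equiv01?
  reps : List (List (V n))
  reps = representatives (filter P? candidates)
  all-P : All P reps
  all-P = All.tabulate (λ r∈ → proj₂ (∈-filter⁻ P? {xs = candidates} (representatives-⊆ _ r∈)))
  cover : ∀ S → P S → Any (Equiv01 S) reps
  cover S PS = representatives-cover equiv01-refl _ (∈-filter⁺ P? (complete S PS) PS)

kVertexSet-numClasses : ∀ n k → ∃ λ m → A-is n k m
kVertexSet-numClasses n k = finite-numClasses kVertexSet? (words k (vertices n)) complete
  where
  kVertexSet? : ∀ S → Dec (KVertexSet n k S)
  kVertexSet? S = DecUnique.unique? _≟V_ S ×-dec (length S ≟ k)
  complete : ∀ S → KVertexSet n k S → S ∈ words k (vertices n)
  complete S (_ , refl) = words-complete S (All.tabulate (λ {x} _ → vertices-complete x))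

numClasses-restrict : ∀ {n} {P Q : List (V n) → Set} {m} →
  (∀ S → P S → Q S) → NumClasses P m → NumClasses (λ S → P S × Q S) m
numClasses-restrict P⇒Q (reps , reps-length , all-P , distinct , cover) =
  reps , reps-length , All.map (λ {S} PS → PS , P⇒Q S PS) all-P , distinct , λ S PQS → cover S (proj₁ PQS)

corollary3p3 : ∀ (n k : ℕ) → 1 ≤ n → 2 ^ (n ∸ 1) < k → k ≤ 2 ^ n →
    ∃ λ (m : ℕ) → A-is n k m × F-is n k m
corollary3p3 zero k () _ _
corollary3p3 (suc n) k _ more-than-half _ with kVertexSet-numClasses (suc n) k
... | m , A-classes =
  m , A-classes , numClasses-restrict (kVertexSet-fullDimensional n k more-than-half) A-classes
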